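{- Let $k\ge1$, let $G=(V,E)$ be a graph and let $\alpha,\beta$ be proper $k$-colourings of $G$ such that an $(\alpha\to\beta)$-recolouring exists, and let $R=c_0,\dots,c_\ell$ be an $(\alpha\to\beta)$-recolouring of minimum length $\ell$. Then every vertex recoloured by $R$ belongs to $A^*=\bigcup_{h=0}^{\ell-1}A_h$.
   Context: A proper $k$-colouring of $G$ is a map $c:V\to\{1,\dots,k\}$ with $c(x)\ne c(y)$ for all $xy\in E$. An $(\alpha\to\beta)$-recolouring of length $\ell$ is a sequence $c_0=\alpha,\dots,c_\ell=\beta$ of proper $k$-colourings in which consecutive colourings disagree on at most one vertex. $R$ recolours a vertex $u$ if $c_q(u)\ne\alpha(u)$ for some $q$. For $u\in V$, $N(u)$ is its set of neighbours, and for $v\in N(u)$, $N(u,v)=\{w\in N(u):\alpha(w)=\alpha(v)\}$. Let $A_0=\{v\in V:\alpha(v)\ne\beta(v)\}$ and, for $i\ge1$, $A_i=\bigcup_{u\in A_{i-1}}\{v\in N(u): |N(u,v)|\le\ell\}$, where $\ell$ is the minimum length above. -}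

module Defs where

open import Data.Nat using (ℕ; zero; suc; _+_; _≤_; _<_)
open import Data.Fin using (Fin; zero; suc)
open import Data.Bool using (Bool; true; false; _∧_)
open import Data.Product using (Σ; ∃; _×_; _,_)
open import Relation.Binary.PropositionalEquality using (_≡_; _≢_)
open import Relation.Nullary using (¬_)
open import Relation.Nullary.Decidable using (⌊_⌋)
open import Data.Fin using (_≟_)

record Graph (n : ℕ) : Set where
  field
    adj   : Fin n → Fin n → Bool
    sym   : ∀ x y → adj x y ≡ adj y x
    irrefl : ∀ x → adj x x ≡ false

open Graph public

Edge : ∀ {n} → Graph n → Fin n → Fin n → Set
Edge G x y = adj G x y ≡ true

Colouring : ℕ → ℕ → Set
Colouring n k = Fin n → Fin k

Proper : ∀ {n k} → Graph n → Colouring n k → Set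
Proper G c = ∀ x y → Edge G x y → c x ≢ c y

AtMostOneDiff : ∀ {n k} → Colouring n k → Colouring n k → Set
AtMostOneDiff {n} c d = Σ (Fin n) λ v → ∀ w → w ≢ v → c w ≡ d w

-- c : ℕ → Colouring is an (α → β)-recolouring of length ℓ (only c 0 … c ℓ matter)
IsRecolouring : ∀ {n k} → Graph n → Colouring n k → Colouring n k →
                ℕ → (ℕ → Colouring n k) → Set
IsRecolouring G α β ℓ c =
  (c 0 ≡ α) × (c ℓ ≡ β) ×
  (∀ q → q ≤ ℓ → Proper G (c q)) ×
  (∀ q → q < ℓ → AtMostOneDiff (c q) (c (suc q)))

RecolouringExists : ∀ {n k} → Graph n → Colouring n k → Colouring n k → ℕ → Set
RecolouringExists {n} {k} G α β ℓ = Σ (ℕ → Colouring n k) λ c → IsRecolouring G α β ℓ c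

Recolours : ∀ {n k} → Colouring n k → ℕ → (ℕ → Colouring n k) → Fin n → Set
Recolours α ℓ c u = Σ ℕ λ q → (q ≤ ℓ) × (c q u ≢ α u)

count : ∀ {n} → (Fin n → Bool) → ℕ
count {zero}  p = 0
count {suc n} p with p zero
... | true  = suc (count (λ i → p (suc i)))
... | false = count (λ i → p (suc i))

sizeNuv : ∀ {n k} → Graph n → Colouring n k → Fin n → Fin n → ℕ
sizeNuv G α u v = count (λ w → adj G u w ∧ ⌊ α w ≟ α v ⌋)

InA : ∀ {n k} → Graph n → Colouring n k → Colouring n k → ℕ → ℕ → Fin n → Set
InA G α β ℓ zero    v = α v ≢ β v
InA G α β ℓ (suc i) v =
  Σ _ λ u → InA G α β ℓ i u × Edge G u v × (sizeNuv G α u v ≤ ℓ)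

InAstar : ∀ {n k} → Graph n → Colouring n k → Colouring n k → ℕ → Fin n → Set
InAstar G α β ℓ v = Σ ℕ λ h → (h < ℓ) × InA G α β ℓ h v

-- Call a vertex covered at stage m if R changes it and it lies in A_0 ∪ … ∪ A_{m−1}.
-- R changes at most ℓ vertices, one per step, so the covered sets stop growing at
-- some stage m ≤ ℓ.  Freeze every changed but uncovered vertex at its α-colour.
-- The frozen colourings stay proper: if x is uncovered, y is covered, xy is an edge
-- and c_p(y) = α(x), then every w ∈ N(y,x) satisfies c_p(w) ≠ c_p(y) = α(w), so w is
-- changed before step p; hence |N(y,x)| ≤ ℓ and x would be covered at stage m + 1.
-- Uncovered vertices are not in A_0, so the frozen sequence is again an
-- (α → β)-recolouring, in which every step that moved an uncovered vertex is idle.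
-- Deleting such a step contradicts the minimality of ℓ.

module Submission where

open import Level using (Level; 0ℓ)
open import Function using (_∘_)
open import Function.Bundles using (Equivalence)
open import Data.Empty using (⊥; ⊥-elim)
open import Data.Bool using (Bool; T; true; false; _∧_; if_then_else_)
import Data.Bool as Bool
open import Data.Bool.Properties using (T-≡)
open import Data.Nat using (ℕ; zero; suc; _+_; _≤_; _<_; z≤n; s≤s; _<?_; _≤?_) renaming (_≟_ to _≟ℕ_)
open import Data.Nat.Properties
  using (≤-refl; ≤-reflexive; ≤-trans; ≤-antisym; ≤-pred; <⇒≤; <⇒≱; ≮⇒≥; <-trans; <-≤-trans;
         ≤∧≢⇒<; n<1+n; n≤1+n; n≮0; 1+n≰n; m≤n⇒m≤1+n; m<n⇒m<1+n; +-suc; +-mono-≤; +-monoʳ-≤;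
         anyUpTo?; module ≤-Reasoning)
open import Data.Fin using (Fin; zero; suc; _≟_)
open import Data.Fin.Properties using (suc-injective; 0≢1+n; any?)
open import Data.Product using (∃; _×_; _,_; proj₁; proj₂)
open import Data.Sum using (_⊎_; inj₁; inj₂)
open import Relation.Nullary using (¬_; yes; no; does; ¬?; _×-dec_; T?)
open import Relation.Nullary.Decidable using (decidable-stable; isYes≗does)
open import Relation.Unary using (Pred; Decidable; _⊆_; _∪_; _∩_; ∁)
open import Relation.Unary.Properties using (_∪?_; _∩?_; ∁?)
open import Relation.Binary.PropositionalEquality
  using (_≡_; _≢_; _≗_; refl; cong; cong-app; sym; trans; subst)

open import Defs hiding (sym)

private variable
  a b : Level

count-cong : ∀ {n} {f g : Fin n → Bool} → f ≗ g → count f ≡ count g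
count-cong {zero}  f≗g = refl
count-cong {suc n} {f} {g} f≗g
  with f zero | g zero | f≗g zero | count-cong {f = f ∘ suc} {g ∘ suc} (f≗g ∘ suc)
... | true  | true  | refl | ih = cong suc ih
... | false | false | refl | ih = ih

∣_∣ : ∀ {n} {P : Pred (Fin n) a} → Decidable P → ℕ
∣ P? ∣ = count (λ x → does (P? x))

∣∣-empty : ∀ {n} {P : Pred (Fin n) a} (P? : Decidable P) → (∀ x → ¬ P x) → ∣ P? ∣ ≡ 0
∣∣-empty {n = zero} P? ¬P = refl
∣∣-empty {n = suc n} P? ¬P with P? zero
... | yes Px = ⊥-elim (¬P zero Px)
... | no  _  = ∣∣-empty (λ x → P? (suc x)) (λ x → ¬P (suc x))

∣∣-mono : ∀ {n} {P : Pred (Fin n) a} {Q : Pred (Fin n) b} (P? : Decidable P) (Q? : Decidable Q) →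
          P ⊆ Q → ∣ P? ∣ ≤ ∣ Q? ∣
∣∣-mono {n = zero} P? Q? P⊆Q = z≤n
∣∣-mono {n = suc n} P? Q? P⊆Q with P? zero | Q? zero
... | yes _  | yes _  = s≤s (∣∣-mono (λ x → P? (suc x)) (λ x → Q? (suc x)) P⊆Q)
... | yes Px | no ¬Qx = ⊥-elim (¬Qx (P⊆Q Px))
... | no  _  | yes _  = m≤n⇒m≤1+n (∣∣-mono (λ x → P? (suc x)) (λ x → Q? (suc x)) P⊆Q)
... | no  _  | no _   = ∣∣-mono (λ x → P? (suc x)) (λ x → Q? (suc x)) P⊆Q

∣∣-mono-< : ∀ {n} {P : Pred (Fin n) a} {Q : Pred (Fin n) b} (P? : Decidable P) (Q? : Decidable Q) →
            P ⊆ Q → ∀ x → Q x → ¬ P x → ∣ P? ∣ < ∣ Q? ∣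
∣∣-mono-< P? Q? P⊆Q zero Qx ¬Px with P? zero | Q? zero
... | yes Px | _      = ⊥-elim (¬Px Px)
... | no _   | no ¬Qx = ⊥-elim (¬Qx Qx)
... | no _   | yes _  = s≤s (∣∣-mono (λ x → P? (suc x)) (λ x → Q? (suc x)) P⊆Q)
∣∣-mono-< P? Q? P⊆Q (suc x) Qx ¬Px with P? zero | Q? zero
... | yes _  | yes _  = s≤s (∣∣-mono-< (λ x → P? (suc x)) (λ x → Q? (suc x)) P⊆Q x Qx ¬Px)
... | yes Px | no ¬Qx = ⊥-elim (¬Qx (P⊆Q Px))
... | no  _  | yes _  = m≤n⇒m≤1+n (∣∣-mono-< (λ x → P? (suc x)) (λ x → Q? (suc x)) P⊆Q x Qx ¬Px)
... | no  _  | no _   = ∣∣-mono-< (λ x → P? (suc x)) (λ x → Q? (suc x)) P⊆Q x Qx ¬Px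

∣∣-∪ : ∀ {n} {P : Pred (Fin n) a} {Q : Pred (Fin n) b} (P? : Decidable P) (Q? : Decidable Q) →
       ∣ P? ∪? Q? ∣ ≤ ∣ P? ∣ + ∣ Q? ∣
∣∣-∪ {n = zero} P? Q? = z≤n
∣∣-∪ {n = suc n} P? Q? with P? zero | Q? zero | ∣∣-∪ (λ x → P? (suc x)) (λ x → Q? (suc x))
... | yes _ | yes _ | ih = s≤s (≤-trans ih (+-monoʳ-≤ _ (n≤1+n _)))
... | yes _ | no  _ | ih = s≤s ih
... | no  _ | yes _ | ih = ≤-trans (s≤s ih) (≤-reflexive (sym (+-suc _ _)))
... | no  _ | no  _ | ih = ih

∣∣-≤1 : ∀ {n} {P : Pred (Fin n) a} (P? : Decidable P) → (∀ {x y} → P x → P y → x ≡ y) → ∣ P? ∣ ≤ 1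
∣∣-≤1 {n = zero} P? unique = z≤n
∣∣-≤1 {n = suc n} P? unique with P? zero
... | yes P0 = s≤s (≤-reflexive (∣∣-empty (λ x → P? (suc x)) (λ x Px → 0≢1+n (unique P0 Px))))
... | no  _  = ∣∣-≤1 (λ x → P? (suc x)) (λ Px Py → suc-injective (unique Px Py))

stabilises-or-grows : ∀ {n} {P : ℕ → Pred (Fin n) a} (P? : ∀ m → Decidable (P m)) →
                      (∀ m → P m ⊆ P (suc m)) →
                      ∀ M → (∃ λ m → m < M × P (suc m) ⊆ P m) ⊎ M ≤ ∣ P? M ∣
stabilises-or-grows P? grows zero = inj₂ z≤n
stabilises-or-grows P? grows (suc M) with stabilises-or-grows P? grows M
... | inj₁ (m , m<M , stable) = inj₁ (m , m<n⇒m<1+n m<M , stable)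
... | inj₂ M≤∣P∣ with any? (λ x → P? (suc M) x ×-dec ¬? (P? M x))
...   | yes (x , Px , ¬Px) = inj₂ (≤-trans (s≤s M≤∣P∣) (∣∣-mono-< (P? M) (P? (suc M)) (grows M) x Px ¬Px))
...   | no ∄x              =
  inj₁ (M , ≤-refl , λ {x} Px → decidable-stable (P? M x) (λ ¬Px → ∄x (x , Px , ¬Px)))

stabilise : ∀ {n} {P : ℕ → Pred (Fin n) a} (P? : ∀ m → Decidable (P m)) N →
            (∀ m → P m ⊆ P (suc m)) → (∀ m → ∣ P? m ∣ ≤ N) →
            ∃ λ m → m ≤ N × P (suc m) ⊆ P m
stabilise P? N grows bounded with stabilises-or-grows P? grows (suc N)
... | inj₁ (m , m<1+N , stable) = m , ≤-pred m<1+N , stable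
... | inj₂ 1+N≤∣P∣              = ⊥-elim (1+n≰n (≤-trans 1+N≤∣P∣ (bounded (suc N))))

Proper-resp-≗ : ∀ {n k} {G : Graph n} {γ δ : Colouring n k} → γ ≗ δ → Proper G γ → Proper G δ
Proper-resp-≗ γ≗δ γ-proper x y xy δx≡δy = γ-proper x y xy (trans (γ≗δ x) (trans δx≡δy (sym (γ≗δ y))))

AtMostOneDiff-resp-≗ : ∀ {n k} {γ γ′ δ δ′ : Colouring n k} → γ ≗ γ′ → δ ≗ δ′ →
                       AtMostOneDiff γ δ → AtMostOneDiff γ′ δ′
AtMostOneDiff-resp-≗ γ≗γ′ δ≗δ′ (v , agree) =
  v , λ w w≢v → trans (sym (γ≗γ′ w)) (trans (agree w w≢v) (δ≗δ′ w))

-- An (α → β)-recolouring whose endpoints agree with α and β only pointwise; without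
-- function extensionality this is what freezing and deleting steps produce.
record PointwiseRecolouring {n k} (G : Graph n) (α β : Colouring n k) (ℓ : ℕ) (e : ℕ → Colouring n k) : Set where
  field
    start  : e 0 ≗ α
    finish : e ℓ ≗ β
    proper : ∀ q → q ≤ ℓ → Proper G (e q)
    step   : ∀ q → q < ℓ → AtMostOneDiff (e q) (e (suc q))

skip : ℕ → ℕ → ℕ
skip q p with p <? q
... | yes _ = p
... | no  _ = suc p

module _ {n k} {G : Graph n} {α β : Colouring n k} where

  open PointwiseRecolouring

  withEndpoints : ℕ → (ℕ → Colouring n k) → ℕ → Colouring n k
  withEndpoints L e zero    = α
  withEndpoints L e (suc p) with p ≟ℕ L
  ... | yes _ = β
  ... | no  _ = e (suc p)

  withEndpoints-≗ : ∀ {L e} → PointwiseRecolouring G α β (suc L) e →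
                    ∀ p → p ≤ suc L → withEndpoints L e p ≗ e p
  withEndpoints-≗ R zero    _ x = sym (start R x)
  withEndpoints-≗ {L} R (suc p) _ x with p ≟ℕ L
  ... | yes refl = sym (finish R x)
  ... | no  _    = refl

  withEndpoints-finish : ∀ L e → withEndpoints L e (suc L) ≡ β
  withEndpoints-finish L e with L ≟ℕ L
  ... | yes _   = refl
  ... | no L≢L = ⊥-elim (L≢L refl)

  toRecolouring : ∀ {L e} → PointwiseRecolouring G α β (suc L) e → RecolouringExists G α β (suc L)
  toRecolouring {L} {e} R =
    withEndpoints L e , refl , withEndpoints-finish L e ,
    (λ q q≤ → Proper-resp-≗ {G = G} (sym ∘ ≗-end q q≤) (proper R q q≤)) ,
    (λ q q< → AtMostOneDiff-resp-≗ (sym ∘ ≗-end q (<⇒≤ q<)) (sym ∘ ≗-end (suc q) q<) (step R q q<))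
    where
    ≗-end : ∀ p → p ≤ suc L → withEndpoints L e p ≗ e p
    ≗-end = withEndpoints-≗ R

  dropIdleStep : ∀ {ℓ e q} → PointwiseRecolouring G α β (suc ℓ) e → q ≤ ℓ → e q ≗ e (suc q) →
                 PointwiseRecolouring G α β ℓ (e ∘ skip q)
  start (dropIdleStep {q = zero}  R _ idle) x = trans (sym (idle x)) (start R x)
  start (dropIdleStep {q = suc q} R _ idle) = start R
  finish (dropIdleStep {ℓ} {q = q} R q≤ℓ idle) with ℓ <? q
  ... | yes ℓ<q = ⊥-elim (<⇒≱ ℓ<q q≤ℓ)
  ... | no  _   = finish R
  proper (dropIdleStep {q = q} R q≤ℓ idle) p p≤ℓ with p <? q
  ... | yes _ = proper R p (m≤n⇒m≤1+n p≤ℓ)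
  ... | no  _ = proper R (suc p) (s≤s p≤ℓ)
  step (dropIdleStep {q = q} R q≤ℓ idle) p p<ℓ with p <? q | suc p <? q
  ... | yes _   | yes _    = step R p (m<n⇒m<1+n p<ℓ)
  ... | yes p<q | no  p≮q  rewrite ≤-antisym (≮⇒≥ p≮q) p<q =
    AtMostOneDiff-resp-≗ (λ _ → refl) idle (step R p (m<n⇒m<1+n p<ℓ))
  ... | no  p≮q | yes p<q = ⊥-elim (p≮q (<-trans (n<1+n p) p<q))
  ... | no  _   | no  _    = step R (suc p) (s≤s p<ℓ)

freeze : ∀ {n k s} {S : Pred (Fin n) s} → Decidable S → Colouring n k → Colouring n k → Colouring n k
freeze S? α γ x = if does (S? x) then α x else γ x

module _ {n k s} {S : Pred (Fin n) s} (S? : Decidable S) {α : Colouring n k} where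

  freeze-proper : ∀ {G γ} → Proper G α → Proper G γ →
                  (∀ {x y} → Edge G x y → S x → ¬ S y → α x ≢ γ y) → Proper G (freeze S? α γ)
  freeze-proper {G} α-proper γ-proper across x y xy with S? x | S? y
  ... | yes _  | yes _  = α-proper x y xy
  ... | no  _  | no  _  = γ-proper x y xy
  ... | yes Sx | no ¬Sy = across xy Sx ¬Sy
  ... | no ¬Sx | yes Sy = λ γx≡αy → across (trans (Graph.sym G y x) xy) Sy ¬Sx (sym γx≡αy)

  freeze-step : ∀ {γ δ} → AtMostOneDiff γ δ → AtMostOneDiff (freeze S? α γ) (freeze S? α δ)
  freeze-step {γ} {δ} (v , agree) = v , λ w w≢v → frozen-agree w (agree w w≢v)
    where
    frozen-agree : ∀ w → γ w ≡ δ w → freeze S? α γ w ≡ freeze S? α δ w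
    frozen-agree w γw≡δw with S? w
    ... | yes _ = refl
    ... | no  _ = γw≡δw

  freeze-idle : ∀ {γ δ u} → AtMostOneDiff γ δ → S u → γ u ≢ δ u → freeze S? α γ ≗ freeze S? α δ
  freeze-idle {u = u} (v , agree) Su γu≢δu x with S? x
  ... | yes _  = refl
  ... | no ¬Sx = agree x x≢v
    where
    x≢v : x ≢ v
    x≢v refl with u ≟ x
    ... | yes refl = ¬Sx Su
    ... | no  u≢x  = γu≢δu (agree u u≢x)

  frozenRecolouring : ∀ {G β ℓ c} → IsRecolouring G α β ℓ c →
                      (∀ {p x y} → p ≤ ℓ → Edge G x y → S x → ¬ S y → α x ≢ c p y) →
                      (∀ {x} → S x → α x ≡ β x) →
                      PointwiseRecolouring G α β ℓ (λ p → freeze S? α (c p))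
  frozenRecolouring {G} {β} {ℓ} {c} (c₀≡α , cℓ≡β , proper , step) across fixed = record
    { start  = start
    ; finish = finish
    ; proper = λ p p≤ℓ → freeze-proper {G} {c p} α-proper (proper p p≤ℓ) (across p≤ℓ)
    ; step   = λ p p<ℓ → freeze-step (step p p<ℓ)
    }
    where
    α-proper : Proper G α
    α-proper = subst (Proper G) c₀≡α (proper 0 z≤n)
    start : freeze S? α (c 0) ≗ α
    start x with S? x
    ... | yes _ = refl
    ... | no  _ = cong-app c₀≡α x
    finish : freeze S? α (c ℓ) ≗ β
    finish x with S? x
    ... | yes Sx = fixed Sx
    ... | no  _  = cong-app cℓ≡β x

module _ {n k} (G : Graph n) (α β : Colouring n k) (ℓ : ℕ) where

  InA? : ∀ h → Decidable (InA G α β ℓ h)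
  InA? zero    v = ¬? (α v ≟ β v)
  InA? (suc h) v = any? λ u → InA? h u ×-dec adj G u v Bool.≟ true ×-dec sizeNuv G α u v ≤? ℓ

  InA< : ℕ → Pred (Fin n) 0ℓ
  InA< m v = ∃ λ h → h < m × InA G α β ℓ h v

  InA<? : ∀ m → Decidable (InA< m)
  InA<? m v = anyUpTo? (λ h → InA? h v) m

noIdleStep : ∀ {n k} {G : Graph n} {α β : Colouring n k} {ℓ e q} →
             (∀ ℓ′ → RecolouringExists G α β ℓ′ → ℓ ≤ ℓ′) → 2 ≤ ℓ →
             PointwiseRecolouring G α β ℓ e → q < ℓ → e q ≗ e (suc q) → ⊥
noIdleStep minimal (s≤s (s≤s _)) R (s≤s q≤) idle = 1+n≰n (minimal _ (toRecolouring (dropIdleStep R q≤ idle)))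

module _ {n k} (G : Graph n) (α β : Colouring n k) (ℓ : ℕ) (c : ℕ → Colouring n k)
         (R : IsRecolouring G α β ℓ c) where

  private
    c₀≡α : c 0 ≡ α
    c₀≡α = proj₁ R
    cℓ≡β : c ℓ ≡ β
    cℓ≡β = proj₁ (proj₂ R)
    proper : ∀ q → q ≤ ℓ → Proper G (c q)
    proper = proj₁ (proj₂ (proj₂ R))
    step : ∀ q → q < ℓ → AtMostOneDiff (c q) (c (suc q))
    step = proj₂ (proj₂ (proj₂ R))
    α-proper : Proper G α
    α-proper = subst (Proper G) c₀≡α (proper 0 z≤n)

  ChangesAt : ℕ → Fin n → Set
  ChangesAt q x = c q x ≢ c (suc q) x

  Changed : Pred (Fin n) 0ℓ
  Changed x = ∃ λ q → q < ℓ × ChangesAt q x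

  changed? : Decidable Changed
  changed? x = anyUpTo? (λ q → ¬? (c q x ≟ c (suc q) x)) ℓ

  changesBefore : ∀ {x} p → c p x ≢ α x → ∃ λ q → q < p × ChangesAt q x
  changesBefore {x} zero    c0x≢αx = ⊥-elim (c0x≢αx (cong-app c₀≡α x))
  changesBefore {x} (suc p) c1+px≢αx with c p x ≟ α x
  ... | yes cpx≡αx = p , ≤-refl , λ cpx≡c1+px → c1+px≢αx (trans (sym cpx≡c1+px) cpx≡αx)
  ... | no  cpx≢αx with changesBefore p cpx≢αx
  ...   | q , q<p , changes = q , m<n⇒m<1+n q<p , changes

  recoloured⇒changed : ∀ {x} → Recolours α ℓ c x → Changed x
  recoloured⇒changed (p , p≤ℓ , cpx≢αx) with changesBefore p cpx≢αx
  ... | q , q<p , changes = q , <-≤-trans q<p p≤ℓ , changes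

  unchanged⇒fixed : ∀ {x p} → ¬ Changed x → p ≤ ℓ → c p x ≡ α x
  unchanged⇒fixed {x} {p} unchanged p≤ℓ =
    decidable-stable (c p x ≟ α x) (λ cpx≢αx → unchanged (recoloured⇒changed (p , p≤ℓ , cpx≢αx)))

  ∣changedBefore∣≤ : ∀ {P : Pred (Fin n) a} (P? : Decidable P) m → m ≤ ℓ →
                     (∀ {x} → P x → ∃ λ q → q < m × ChangesAt q x) → ∣ P? ∣ ≤ m
  ∣changedBefore∣≤ P? zero _ changes =
    ≤-reflexive (∣∣-empty P? (λ _ Px → n≮0 (proj₁ (proj₂ (changes Px)))))
  ∣changedBefore∣≤ {P = P} P? (suc m) m<ℓ changes =
    begin
      ∣ P? ∣                   ≤⟨ ∣∣-mono P? (≡v? ∪? rest?) split ⟩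
      ∣ ≡v? ∪? rest? ∣         ≤⟨ ∣∣-∪ ≡v? rest? ⟩
      ∣ ≡v? ∣ + ∣ rest? ∣      ≤⟨ +-mono-≤ (∣∣-≤1 ≡v? λ x≡v y≡v → trans x≡v (sym y≡v)) rest-bound ⟩
      suc m                    ∎
    where
    open ≤-Reasoning
    v : Fin n
    v = proj₁ (step m m<ℓ)
    ≡v? : Decidable (_≡ v)
    ≡v? = _≟ v
    rest? : Decidable (P ∩ ∁ (_≡ v))
    rest? = P? ∩? ∁? ≡v?
    split : P ⊆ (_≡ v) ∪ (P ∩ ∁ (_≡ v))
    split {x} Px with x ≟ v
    ... | yes x≡v = inj₁ x≡v
    ... | no  x≢v = inj₂ (Px , x≢v)
    rest-bound : ∣ rest? ∣ ≤ m
    rest-bound = ∣changedBefore∣≤ rest? m (<⇒≤ m<ℓ) λ { {x} (Px , x≢v) → earlier (changes Px) x≢v }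
      where
      -- step m moves only v
      earlier : ∀ {x} → (∃ λ q → q < suc m × ChangesAt q x) → x ≢ v → ∃ λ q → q < m × ChangesAt q x
      earlier {x} (q , q<1+m , changes) x≢v =
        q , ≤∧≢⇒< (≤-pred q<1+m) (λ { refl → changes (proj₂ (step m m<ℓ) x x≢v) }) , changes

  ⊆Changed⇒∣∣≤ℓ : ∀ {P : Pred (Fin n) a} (P? : Decidable P) → P ⊆ Changed → ∣ P? ∣ ≤ ℓ
  ⊆Changed⇒∣∣≤ℓ P? P⊆Changed = ∣changedBefore∣≤ P? ℓ ≤-refl P⊆Changed

  sizeNuv≤ℓ : ∀ {p x y} → p ≤ ℓ → c p y ≡ α x → sizeNuv G α y x ≤ ℓ
  sizeNuv≤ℓ {p} {x} {y} p≤ℓ cpy≡αx = begin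
      -- sizeNuv is phrased with ⌊_⌋, which unlike does only computes on a constructor
      sizeNuv G α y x ≡⟨ count-cong (λ w → cong (adj G y w ∧_) (isYes≗does (α w ≟ α x))) ⟩
      ∣ N? ∣          ≤⟨ ⊆Changed⇒∣∣≤ℓ N? changed ⟩
      ℓ               ∎
    where
    open ≤-Reasoning
    N? : Decidable (λ w → T (adj G y w) × α w ≡ α x)
    N? w = T? (adj G y w) ×-dec α w ≟ α x
    changed : ∀ {w} → T (adj G y w) × α w ≡ α x → Changed w
    changed {w} (yw , αw≡αx) = recoloured⇒changed (p , p≤ℓ , λ cpw≡αw →
      proper p p≤ℓ y w (Equivalence.to T-≡ yw) (trans cpy≡αx (trans (sym αw≡αx) (sym cpw≡αw))))

  Covered : ℕ → Pred (Fin n) 0ℓ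
  Covered m = Changed ∩ InA< G α β ℓ m

  covered? : ∀ m → Decidable (Covered m)
  covered? m = changed? ∩? InA<? G α β ℓ m

  Covered-grows : ∀ m → Covered m ⊆ Covered (suc m)
  Covered-grows m (changed , h , h<m , x∈Aₕ) = changed , h , m<n⇒m<1+n h<m , x∈Aₕ

  ∣covered∣≤ℓ : ∀ m → ∣ covered? m ∣ ≤ ℓ
  ∣covered∣≤ℓ m = ⊆Changed⇒∣∣≤ℓ (covered? m) proj₁

  module _ {m} (stable : Covered (suc m) ⊆ Covered m) where

    Uncovered : Pred (Fin n) 0ℓ
    Uncovered = Changed ∩ ∁ (InA< G α β ℓ m)

    uncovered? : Decidable Uncovered
    uncovered? = changed? ∩? ∁? (InA<? G α β ℓ m)

    uncovered⇒α≡β : ∀ {x} → Uncovered x → α x ≡ β x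
    uncovered⇒α≡β {x} (changedˣ , x∉A<m) =
      decidable-stable (α x ≟ β x) (λ αx≢βx → x∉A<m (proj₂ (stable (changedˣ , 0 , s≤s z≤n , αx≢βx))))

    uncovered-across : ∀ {p x y} → p ≤ ℓ → Edge G x y → Uncovered x → ¬ Uncovered y → α x ≢ c p y
    uncovered-across {p} {x} {y} p≤ℓ xy (changedˣ , x∉A<m) ¬uncoveredʸ αx≡cpy with changed? y
    ... | no  unchangedʸ = α-proper x y xy (trans αx≡cpy (unchanged⇒fixed unchangedʸ p≤ℓ))
    ... | yes changedʸ
      with decidable-stable (InA<? G α β ℓ m y) (λ y∉A<m → ¬uncoveredʸ (changedʸ , y∉A<m))
    ...   | h , h<m , y∈Aₕ = x∉A<m (proj₂ (stable (changedˣ , suc h , s≤s h<m , x∈A₁₊ₕ)))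
      where
      x∈A₁₊ₕ : InA G α β ℓ (suc h) x
      x∈A₁₊ₕ = y , y∈Aₕ , trans (Graph.sym G y x) xy , sizeNuv≤ℓ p≤ℓ (sym αx≡cpy)

  recoloured-length≥2 : ∀ {u} → Recolours α ℓ c u → α u ≡ β u → 2 ≤ ℓ
  recoloured-length≥2 {u} (zero  , _      , c0u≢αu) _ = ⊥-elim (c0u≢αu (cong-app c₀≡α u))
  recoloured-length≥2 {u} (suc q , 1+q≤ℓ , cqu≢αu) αu≡βu =
    ≤-trans (s≤s (s≤s z≤n)) (≤∧≢⇒< 1+q≤ℓ λ 1+q≡ℓ →
      cqu≢αu (trans (cong (λ i → c i u) 1+q≡ℓ) (trans (cong-app cℓ≡β u) (sym αu≡βu))))

  recoloured⇒InAstar : (∀ ℓ′ → RecolouringExists G α β ℓ′ → ℓ ≤ ℓ′) →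
                       ∀ u → Recolours α ℓ c u → InAstar G α β ℓ u
  recoloured⇒InAstar minimal u recoloured with α u ≟ β u | recoloured⇒changed recoloured
  ... | no αu≢βu  | _ , q<ℓ , _ = 0 , ≤-trans (s≤s z≤n) q<ℓ , αu≢βu
  ... | yes αu≡βu | changed@(q , q<ℓ , changes) with stabilise covered? ℓ Covered-grows ∣covered∣≤ℓ
  ... | m , m≤ℓ , stable with InA<? G α β ℓ m u
  ... | yes (h , h<m , u∈Aₕ) = h , <-≤-trans h<m m≤ℓ , u∈Aₕ
  ... | no  u∉A<m = ⊥-elim (noIdleStep minimal (recoloured-length≥2 recoloured αu≡βu) frozen q<ℓ idle)
    where
    S? : Decidable (Uncovered stable)
    S? = uncovered? stable
    frozen : PointwiseRecolouring G α β ℓ (λ p → freeze S? α (c p))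
    frozen = frozenRecolouring S? R (uncovered-across stable) (uncovered⇒α≡β stable)
    idle : freeze S? α (c q) ≗ freeze S? α (c (suc q))
    idle = freeze-idle S? (step q q<ℓ) (changed , u∉A<m) changes

lemma16 : (n k : ℕ) → 1 ≤ k → (G : Graph n) → (α β : Colouring n k) →
          Proper G α → Proper G β →
          (ℓ : ℕ) → (c : ℕ → Colouring n k) → IsRecolouring G α β ℓ c →
          (∀ ℓ′ → RecolouringExists G α β ℓ′ → ℓ ≤ ℓ′) →
          ∀ u → Recolours α ℓ c u → InAstar G α β ℓ u
lemma16 _ _ _ G α β _ _ ℓ c R minimal = recoloured⇒InAstar G α β ℓ c R minimal
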